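{- Let $n\geq 3$, $s\geq 1$ and $r\geq 2$ be integers, let $G$ be an even carousel or an odd carousel of order $s$ on $n$ sets $X_1,\dots,X_n$, and let $(Y,Z)$ be a partition of $V(G)$ with $\mathrm{rk}_G(Y,Z)<r$. Then $X_1$ has fewer than $8r$ blocks with respect to $(Y,Z)$.
   Context: All graphs are finite and simple. Let $X=\{u^1,\dots,u^k\}$ and $X'=\{v^1,\dots,v^k\}$ be two disjoint ordered sets of $k$ vertices of a graph $G$. The triple $(G,X,X')$ is called: - a regular matching if for all $j,j'\in\{1,\dots,k\}$: $u^jv^{j'}\in E(G)$ iff $j=j'$; - a regular antimatching if: $u^jv^{j'}\in E(G)$ iff $j\neq j'$; - a regular crossing if: $u^jv^{j'}\in E(G)$ iff $j+j'\geq k+1$; - an expanding matching if: $u^jv^{j'}\in E(G)$ iff $j'=2j$ or $j'=2j+1$; - an expanding antimatching if: $u^jv^{j'}\in E(G)$ iff $j'\neq 2j$ and $j'\neq 2j+1$; - an expanding crossing if: $u^jv^{j'}\in E(G)$ iff $2j+j'\geq 2k+2$; - (when $k\equiv 2 \pmod 4$) a skew expanding matching if, for all $j'$: for $1\le j\le (k-2)/4$, $u^jv^{j'}\in E(G)$ iff $j'\in\{2j,2j+1\}$; for $(k-2)/4< j\le (3k+2)/4$, $u^jv^{j'}\notin E(G)$; for $(3k+2)/4<j\le k$, $u^jv^{j'}\in E(G)$ iff $j'\in\{2j-k-2,2j-k-1\}$; - (when $k\equiv 2\pmod 4$) a skew expanding antimatching: as the skew expanding matching except that for $(k-2)/4<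 j\le (3k+2)/4$, $u^jv^{j'}\in E(G)$ for all $j'$; - (when $k\equiv 2\pmod 4$) a skew expanding crossing if, for all $j'$: for $1\le j\le (k-2)/4$, $u^jv^{j'}\in E(G)$ iff $2j+j'\geq k$; for $(k-2)/4<j\le k/2$, iff $j'\geq k/2+1$; for $k/2<j\le (3k+2)/4$, iff $j'\geq k/2-1$; for $(3k+2)/4<j\le k$, iff $2j+j'-2\geq 2k$. Regular/expanding/skew expanding triples are those of the respective three kinds; crossings are cross triples, matchings and antimatchings are parallel triples. A carousel on $n\geq 3$ sets of cardinality $k$: $V(G)=X_1\cup\dots\cup X_n$ disjoint, $X_i=\{x_i^1,\dots,x_i^k\}$ ordered, $(G,X_1,X_2)$ a regular crossing, $(G,X_i,X_{i+1})$ regular for $2\le i\le n-1$, $(G,X_n,X_1)$ expanding or skew expanding; other edges arbitrary. An even carousel of order $s$: $k=2^s-1$, an even number of cross triples among $(G,X_i,X_{i+1})$, $i=1,\dots,n$ (indices mod $n$), and $(G,X_n,X_1)$ expanding. An odd carousel of order $s$: $k=2(2^s-1)$, an odd number of such cross triples, and $(G,X_n,X_1)$ skew expanding. For disjoint $Y,Z\subseteq V(G)$, $\mathrm{rk}_G(Y,Z)$ is the $\mathrm{GF}(2)$-rank of the 0-1 adjacency matrix with rows $Y$ and columns $Z$. For the ordered set $X_1$, an interval is a set $\{x_1^a,x_1^{a+1},\dots,x_1^b\}$; a block of $X_1$ with respect to $(Y,Z)$ is a non-empty interval contained in $Y$ or in $Z$ and maximal with this property. -}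

module Defs where

open import Data.Nat using (ℕ; zero; suc; _+_; _*_; _∸_; _^_; _≤_; _<_; z≤n; s≤s; _≡ᵇ_)
open import Data.Nat.DivMod using (_/_)
open import Data.Nat.Divisibility using (_∣_)
open import Data.Bool using (Bool; true; false; _xor_; _∧_; if_then_else_)
open import Data.Fin using (Fin; zero; suc; toℕ)
open import Data.Product using (_×_; _,_; Σ)
open import Data.Sum using (_⊎_)
open import Data.Empty using (⊥)
open import Relation.Nullary using (¬_)
open import Relation.Binary.PropositionalEquality using (_≡_; _≢_)
open import Function.Bundles using (_⇔_)

-- Vertices: V(G) = X_1 ∪ … ∪ X_n with X_i = {x_i^1,…,x_i^k}.
-- Vertex x_i^j is represented by (i-1 , j-1) : Fin n × Fin k.

V : ℕ → ℕ → Set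
V n k = Fin n × Fin k

record Graph (n k : ℕ) : Set where
  field
    adj   : V n k → V n k → Bool
    sym   : ∀ u v → adj u v ≡ adj v u
    irref : ∀ v → adj v v ≡ false
open Graph public

-- Edge patterns, with 1-based indices j, j' ∈ {1,…,k}.

Pattern : Set₁
Pattern = ℕ → ℕ → ℕ → Set   -- k → j → j' → "u^j v^j' is an edge"

regMatch regAnti regCross : Pattern
regMatch k j j' = j ≡ j'
regAnti  k j j' = j ≢ j'
regCross k j j' = k + 1 ≤ j + j'

expMatch expAnti expCross : Pattern
expMatch k j j' = (j' ≡ 2 * j) ⊎ (j' ≡ 2 * j + 1)
expAnti  k j j' = (j' ≢ 2 * j) × (j' ≢ 2 * j + 1)
expCross k j j' = 2 * k + 2 ≤ 2 * j + j'

-- Skew patterns (meaningful when k ≡ 2 mod 4). Each is given casewise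
-- on j, the four ranges for j partitioning {1,…,k}.
lowB highB : ℕ → ℕ
lowB k  = (k ∸ 2) / 4
highB k = (3 * k + 2) / 4

skewMatch skewAnti skewCross : Pattern
skewMatch k j j' =
    (j ≤ lowB k → (j' ≡ 2 * j) ⊎ (j' ≡ 2 * j + 1))
  × (lowB k < j → j ≤ highB k → ⊥)
  × (highB k < j → (j' ≡ 2 * j ∸ k ∸ 2) ⊎ (j' ≡ 2 * j ∸ k ∸ 1))
skewAnti k j j' =
    (j ≤ lowB k → (j' ≡ 2 * j) ⊎ (j' ≡ 2 * j + 1))
  × (highB k < j → (j' ≡ 2 * j ∸ k ∸ 2) ⊎ (j' ≡ 2 * j ∸ k ∸ 1))
skewCross k j j' =
    (j ≤ lowB k → k ≤ 2 * j + j')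
  × (lowB k < j → j ≤ k / 2 → k / 2 + 1 ≤ j')
  × (k / 2 < j → j ≤ highB k → k / 2 ∸ 1 ≤ j')
  × (highB k < j → 2 * k ≤ 2 * j + j' ∸ 2)

data Shape : Set where
  regular expanding skewExpanding : Shape

data Kind : Set where
  matching antimatching crossing : Kind

patternOf : Shape → Kind → Pattern
patternOf regular        matching     = regMatch
patternOf regular        antimatching = regAnti
patternOf regular        crossing     = regCross
patternOf expanding      matching     = expMatch
patternOf expanding      antimatching = expAnti
patternOf expanding      crossing     = expCross
patternOf skewExpanding  matching     = skewMatch
patternOf skewExpanding  antimatching = skewAnti
patternOf skewExpanding  crossing     = skewCross

IsTriple : ∀ {n k} → Graph n k → Fin n → Fin n → Shape → Kind → Set
IsTriple {n} {k} G a b sh kd =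
  ∀ (j j' : Fin k) →
    (adj G (a , j) (b , j') ≡ true) ⇔ patternOf sh kd k (suc (toℕ j)) (suc (toℕ j'))

Next : (n : ℕ) → Fin n → Fin n → Set
Next n a b = (suc (toℕ a) ≡ toℕ b) ⊎ ((suc (toℕ a) ≡ n) × (toℕ b ≡ 0))

shapeAt : (n : ℕ) → Fin n → Shape → Shape
shapeAt n i last = if suc (toℕ i) ≡ᵇ n then last else regular

-- A carousel on n sets of cardinality k whose closing triple has shape
-- 'last'; the kind of each triple (X_i,X_{i+1}) is recorded.
record Carousel {n k : ℕ} (G : Graph n k) (last : Shape) : Set where
  field
    kind        : Fin n → Kind
    firstCross  : ∀ i → toℕ i ≡ 0 → kind i ≡ crossing
    triples     : ∀ a b → Next n a b → IsTriple G a b (shapeAt n a last) (kind a)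
open Carousel public

isCross : Kind → Bool
isCross crossing = true
isCross _        = false

count : ∀ {m} → (Fin m → Bool) → ℕ
count {zero}  f = 0
count {suc m} f = (if f zero then 1 else 0) + count (λ i → f (suc i))

crossCount : ∀ {n k} {G : Graph n k} {last} → Carousel G last → ℕ
crossCount c = count (λ i → isCross (kind c i))

EvenCarousel : ∀ {n k} → Graph n k → ℕ → Set
EvenCarousel {n} {k} G s =
  (k ≡ 2 ^ s ∸ 1) × Σ (Carousel G expanding) (λ c → 2 ∣ crossCount c)

OddCarousel : ∀ {n k} → Graph n k → ℕ → Set
OddCarousel {n} {k} G s =
  (k ≡ 2 * (2 ^ s ∸ 1)) × Σ (Carousel G skewExpanding) (λ c → ¬ (2 ∣ crossCount c))

-- GF(2)-rank: rk_G(Y,Z) is the maximum number of linearly independent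
-- rows (over GF(2)) of the adjacency matrix with rows Y and columns Z,
-- where Z = V(G) ∖ Y (Y given by its indicator function).

xorSum : ∀ {m} → (Fin m → Bool) → Bool
xorSum {zero}  f = false
xorSum {suc m} f = f zero xor xorSum (λ i → f (suc i))

IndepRows : ∀ {n k} → Graph n k → (V n k → Bool) → ∀ {m} → (Fin m → V n k) → Set
IndepRows {n} {k} G Y {m} ρ =
  (∀ i → Y (ρ i) ≡ true) ×
  (∀ (c : Fin m → Bool) →
     (∀ z → Y z ≡ false → xorSum (λ i → c i ∧ adj G (ρ i) z) ≡ false) →
     ∀ i → c i ≡ false)

RankLess : ∀ {n k} → Graph n k → (V n k → Bool) → ℕ → Set
RankLess {n} {k} G Y r =
  ∀ (m : ℕ) (ρ : Fin m → V n k) → IndepRows G Y ρ → m < r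

-- Blocks of X_1 w.r.t. (Y,Z); col j = true iff x_1^{j} ∈ Y.
-- An interval is a pair (a , b) with a ≤ b, denoting {x_1^a,…,x_1^b}.

InSide : ∀ {k} → (Fin k → Bool) → Bool → Fin k → Fin k → Set
InSide {k} col side a b = ∀ (j : Fin k) → toℕ a ≤ toℕ j → toℕ j ≤ toℕ b → col j ≡ side

Mono : ∀ {k} → (Fin k → Bool) → Fin k → Fin k → Set
Mono col a b = (toℕ a ≤ toℕ b) × (InSide col true a b ⊎ InSide col false a b)

IsBlock : ∀ {k} → (Fin k → Bool) → Fin k → Fin k → Set
IsBlock {k} col a b =
  Mono col a b ×
  (∀ (a' b' : Fin k) → toℕ a' ≤ toℕ a → toℕ b ≤ toℕ b' → Mono col a' b' →
     (a' ≡ a) × (b' ≡ b))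

FewerBlocksThan : ∀ {k} → (Fin k → Bool) → ℕ → Set
FewerBlocksThan {k} col N =
  ∀ (m : ℕ) (β : Fin m → Fin k × Fin k) →
    (∀ i i' → β i ≡ β i' → i ≡ i') →
    (∀ i → IsBlock col (Data.Product.proj₁ (β i)) (Data.Product.proj₂ (β i))) →
    m < N

firstIdx : ∀ {n} → 3 ≤ n → Fin n
firstIdx (s≤s _) = zero

{-# OPTIONS --safe #-}
-- Only the regular crossing (X₁, X₂) is used: listing X₂ backwards as y₀, y₁, …, it is the half
-- graph x_j ~ y_t ⇔ t ≤ j.  Every block of X₁ but the first starts at a change point a, where x_{a-1}
-- and x_a lie on different sides of (Y, Z), so one of them, x_w, lies on the side opposite y_{a-1}.
-- Sort the change points into four classes by the parity of a and the side of x_w.  Within a class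
-- distinct change points are at least 2 apart, so the pairs (x_w, y_{a-1}) span a triangular
-- submatrix of the Y × Z matrix with ones on the diagonal, which has full GF(2)-rank.  Hence every
-- class has fewer than r points, and X₁ has at most 4(r - 1) + 1 < 8r blocks.

module Submission where

open import Defs renaming (sym to adj-sym)
open import Data.Nat using (ℕ; zero; suc; pred; _+_; _*_; _∸_; _≤_; _<_; z≤n; s≤s; s≤s⁻¹; _≤′_; ≤′-refl; ≤′-step)
open import Data.Nat.Properties
open import Data.Bool using (Bool; true; false; not; _xor_; _∧_; if_then_else_)
open import Data.Bool.Properties using (∧-identityʳ; ∧-zeroʳ; xor-identityʳ; ¬-not; not-¬; ∧-conicalˡ; ∧-conicalʳ)
open import Data.Fin using (Fin; zero; suc; toℕ; fromℕ<; inject₁; opposite)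
import Data.Fin.Properties as Fin
open import Data.Product using (_×_; _,_; Σ; proj₁; proj₂)
import Data.Sum as Sum
open import Data.Sum using (_⊎_; inj₁; inj₂)
open import Relation.Nullary using (¬_; yes; no; contradiction)
open import Relation.Binary.Definitions using (tri<; tri≈; tri>)
open import Relation.Binary.PropositionalEquality using (_≡_; _≢_; refl; sym; trans; cong; cong₂; subst; subst₂; module ≡-Reasoning)
open import Data.Nat.Induction using (<-rec)
open import Function using (_∘_)
open import Function.Definitions using (Injective)
open import Function.Bundles using (_⇔_; mk⇔; Equivalence)
import Function.Properties.Equivalence as ⇔
open import Algebra.Properties.CommutativeSemigroup +-commutativeSemigroup using (interchange)
open import Data.Nat.Tactic.RingSolver using (solve-∀)

xorSum-false : ∀ {m} (f : Fin m → Bool) → (∀ i → f i ≡ false) → xorSum f ≡ false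
xorSum-false {zero}  f all-false = refl
xorSum-false {suc m} f all-false rewrite all-false zero = xorSum-false (f ∘ suc) (all-false ∘ suc)

xorSum-single : ∀ {m} (f : Fin m → Bool) (l : Fin m) → (∀ i → i ≢ l → f i ≡ false) → xorSum f ≡ f l
xorSum-single {suc m} f zero    off =
  trans (cong (f zero xor_) (xorSum-false (f ∘ suc) (λ i → off (suc i) λ ()))) (xor-identityʳ (f zero))
xorSum-single {suc m} f (suc l) off rewrite off zero (λ ()) =
  xorSum-single (f ∘ suc) l (λ i i≢l → off (suc i) (i≢l ∘ Fin.suc-injective))

triangular⇒IndepRows : ∀ {n k} (G : Graph n k) (Y : V n k → Bool) {m}
  (ρ σ : Fin m → V n k) (κ : Fin m → ℕ) →
  (∀ i → Y (ρ i) ≡ true) → (∀ l → Y (σ l) ≡ false) →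
  (∀ i → adj G (ρ i) (σ i) ≡ true) →
  (∀ i l → κ l < κ i → adj G (ρ i) (σ l) ≡ false) →
  Injective _≡_ _≡_ κ →
  IndepRows G Y ρ
triangular⇒IndepRows G Y {m} ρ σ κ ρ∈Y σ∉Y diagonal upper κ-injective = ρ∈Y , trivial-only
  where
  trivial-only : ∀ (c : Fin m → Bool) →
    (∀ z → Y z ≡ false → xorSum (λ i → c i ∧ adj G (ρ i) z) ≡ false) → ∀ l → c l ≡ false
  trivial-only c dependent l = <-rec (λ x → ∀ l → κ l ≡ x → c l ≡ false) step (κ l) l refl
    where
    -- In column σ l, rows of larger key vanish and rows of smaller key have coefficient 0.
    step : ∀ x → (∀ {y} → y < x → ∀ l → κ l ≡ y → c l ≡ false) → ∀ l → κ l ≡ x → c l ≡ false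
    step x ih l refl = begin
      c l                                        ≡⟨ ∧-identityʳ (c l) ⟨
      c l ∧ true                                 ≡⟨ cong (c l ∧_) (diagonal l) ⟨
      c l ∧ adj G (ρ l) (σ l)                    ≡⟨ xorSum-single _ l off-diagonal ⟨
      xorSum (λ i → c i ∧ adj G (ρ i) (σ l))     ≡⟨ dependent (σ l) (σ∉Y l) ⟩
      false                                      ∎
      where
      open ≡-Reasoning
      off-diagonal : ∀ i → i ≢ l → c i ∧ adj G (ρ i) (σ l) ≡ false
      off-diagonal i i≢l with <-cmp (κ i) (κ l)
      ... | tri< κi<κl _ _ rewrite ih κi<κl i refl = refl
      ... | tri≈ _ κi≡κl _ = contradiction (κ-injective κi≡κl) i≢l
      ... | tri> _ _ κl<κi rewrite upper i l κl<κi = ∧-zeroʳ (c i)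

indicator : Bool → ℕ
indicator b = if b then 1 else 0

indicator-split : ∀ x y → indicator x ≡ indicator (x ∧ y) + indicator (x ∧ not y)
indicator-split false y     = refl
indicator-split true  true  = refl
indicator-split true  false = refl

countBelow : (ℕ → Bool) → ℕ → ℕ
countBelow f zero    = 0
countBelow f (suc p) = countBelow f p + indicator (f p)

countBelow-mono : ∀ f {p q} → p ≤ q → countBelow f p ≤ countBelow f q
countBelow-mono f = mono′ ∘ ≤⇒≤′
  where
  mono′ : ∀ {p q} → p ≤′ q → countBelow f p ≤ countBelow f q
  mono′ ≤′-refl                = ≤-refl
  mono′ (≤′-step {n = q} p≤′q) = ≤-trans (mono′ p≤′q) (m≤m+n (countBelow f q) _)

countBelow-strict : ∀ f {p q} → f p ≡ true → p < q → countBelow f p < countBelow f q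
countBelow-strict f {p} {q} fp p<q = begin-strict
  countBelow f p                        <⟨ n<1+n _ ⟩
  suc (countBelow f p)                  ≡⟨ +-comm 1 (countBelow f p) ⟩
  countBelow f p + indicator true       ≡⟨ cong (λ b → countBelow f p + indicator b) fp ⟨
  countBelow f (suc p)                  ≤⟨ countBelow-mono f p<q ⟩
  countBelow f q                        ∎
  where open ≤-Reasoning

countBelow-split : ∀ (f g : ℕ → Bool) p →
  countBelow f p ≡ countBelow (λ a → f a ∧ g a) p + countBelow (λ a → f a ∧ not (g a)) p
countBelow-split f g zero    = refl
countBelow-split f g (suc p) =
  trans (cong₂ _+_ (countBelow-split f g p) (indicator-split (f p) (g p)))
        (interchange (countBelow (λ a → f a ∧ g a) p) _ (indicator (f p ∧ g p)) _)

record Distinct (f : ℕ → Bool) (p m : ℕ) : Set where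
  field
    point     : Fin m → ℕ
    holds     : ∀ i → f (point i) ≡ true
    below     : ∀ i → point i < p
    injective : Injective _≡_ _≡_ point

countBelow-injective : ∀ f {p q} → f p ≡ true → f q ≡ true →
  countBelow f p ≡ countBelow f q → p ≡ q
countBelow-injective f {p} {q} fp fq same with <-cmp p q
... | tri< p<q _ _ = contradiction same (<⇒≢ (countBelow-strict f fp p<q))
... | tri≈ _ p≡q _ = p≡q
... | tri> _ _ q<p = contradiction (sym same) (<⇒≢ (countBelow-strict f fq q<p))

Distinct⇒≤countBelow : ∀ {f p m} → Distinct f p m → m ≤ countBelow f p
Distinct⇒≤countBelow {f} {p} {m} d = ≮⇒≥ too-many
  where
  open Distinct d
  rank : Fin m → Fin (countBelow f p)
  rank i = fromℕ< (countBelow-strict f (holds i) (below i))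
  rank-injective : Injective _≡_ _≡_ rank
  rank-injective {i} {l} same = injective (countBelow-injective f (holds i) (holds l)
    (trans (sym (Fin.toℕ-fromℕ< _)) (trans (cong toℕ same) (Fin.toℕ-fromℕ< _))))
  too-many : ¬ (countBelow f p < m)
  too-many c<m with i , l , i<l , same ← Fin.pigeonhole c<m rank = <⇒≢ i<l (cong toℕ (rank-injective same))

Distinct-empty : ∀ {f p} → Distinct f p 0
Distinct-empty = record { point = λ () ; holds = λ () ; below = λ () ; injective = λ { {()} } }

Distinct-weaken : ∀ {f p m} → Distinct f p m → Distinct f (suc p) m
Distinct-weaken d = record { Distinct d ; below = m<n⇒m<1+n ∘ Distinct.below d }

Distinct-cons : ∀ {f p m} → f p ≡ true → Distinct f p m → Distinct f (suc p) (suc m)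
Distinct-cons {f} {p} {m} fp d =
  record { point = point′ ; holds = holds′ ; below = below′ ; injective = injective′ }
  where
  open Distinct d
  point′ : Fin (suc m) → ℕ
  point′ zero    = p
  point′ (suc i) = point i
  holds′ : ∀ i → f (point′ i) ≡ true
  holds′ zero    = fp
  holds′ (suc i) = holds i
  below′ : ∀ i → point′ i < suc p
  below′ zero    = ≤-refl
  below′ (suc i) = m<n⇒m<1+n (below i)
  injective′ : Injective _≡_ _≡_ point′
  injective′ {zero}  {zero}  _    = refl
  injective′ {zero}  {suc l} same = contradiction (below l) (<-irrefl (sym same))
  injective′ {suc i} {zero}  same = contradiction (below i) (<-irrefl same)
  injective′ {suc i} {suc l} same = cong suc (injective same)

≤countBelow⇒Distinct : ∀ f p m → m ≤ countBelow f p → Distinct f p m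
≤countBelow⇒Distinct f p       zero    _ = Distinct-empty
≤countBelow⇒Distinct f zero    (suc m) ()
≤countBelow⇒Distinct f (suc p) (suc m) m<c with f p in fp
... | false = Distinct-weaken (≤countBelow⇒Distinct f p (suc m) (subst (suc m ≤_) (+-identityʳ _) m<c))
... | true  = Distinct-cons fp (≤countBelow⇒Distinct f p m (≤-pred (subst (suc m ≤_) (+-comm _ 1) m<c)))

-- Positions j ≥ k get the junk value false.
extend : ∀ {k} → (Fin k → Bool) → ℕ → Bool
extend {zero}  col _       = false
extend {suc k} col zero    = col zero
extend {suc k} col (suc j) = extend (col ∘ suc) j

extend-toℕ : ∀ {k} (col : Fin k → Bool) (j : Fin k) → extend col (toℕ j) ≡ col j
extend-toℕ {suc k} col zero    = refl
extend-toℕ {suc k} col (suc j) = extend-toℕ (col ∘ suc) j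

extend-fromℕ< : ∀ {k} (col : Fin k → Bool) {j} (j<k : j < k) → extend col j ≡ col (fromℕ< j<k)
extend-fromℕ< col j<k = trans (cong (extend col) (sym (Fin.toℕ-fromℕ< j<k))) (extend-toℕ col _)

extend-inject₁ : ∀ {k} (col : Fin (suc k) → Bool) (j : Fin k) → extend col (toℕ j) ≡ col (inject₁ j)
extend-inject₁ col j = trans (cong (extend col) (sym (Fin.toℕ-inject₁ j))) (extend-toℕ col (inject₁ j))

changesAt : (ℕ → Bool) → ℕ → Bool
changesAt P zero    = false
changesAt P (suc a) = P a xor P (suc a)

startsAt : (ℕ → Bool) → ℕ → Bool
startsAt P zero    = true
startsAt P (suc a) = changesAt P (suc a)

countBelow-startsAt : ∀ P p → countBelow (startsAt P) p ≤ suc (countBelow (changesAt P) p)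
countBelow-startsAt P zero          = z≤n
countBelow-startsAt P (suc zero)    = ≤-refl
countBelow-startsAt P (suc (suc p)) =
  +-monoˡ-≤ (indicator (changesAt P (suc p))) (countBelow-startsAt P (suc p))

≢⇒xor≡true : ∀ {x y} → x ≢ y → x xor y ≡ true
≢⇒xor≡true {true}  {true}  x≢y = contradiction refl x≢y
≢⇒xor≡true {true}  {false} _   = refl
≢⇒xor≡true {false} {true}  _   = refl
≢⇒xor≡true {false} {false} x≢y = contradiction refl x≢y

IsBlock⇒boundary : ∀ {k} {col : Fin (suc k) → Bool} {a : Fin k} {b} →
  IsBlock col (suc a) b → col (inject₁ a) ≢ col (suc a)
IsBlock⇒boundary {k} {col} {a} {b} ((a<b , side) , maximal) same = 1+n≢n (sym a≡1+a)
  where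
  a′ : Fin (suc k)
  a′ = inject₁ a
  widen : ∀ s → InSide col s (suc a) b → InSide col s a′ b
  widen s inside j a′≤j j≤b with toℕ j ≟ toℕ a
  ... | yes j≡a = trans (cong col (Fin.toℕ-injective (trans j≡a (sym (Fin.toℕ-inject₁ a)))))
                    (trans same (inside (suc a) ≤-refl a<b))
  ... | no  j≢a = inside j (≤∧≢⇒< (subst (_≤ toℕ j) (Fin.toℕ-inject₁ a) a′≤j) (j≢a ∘ sym)) j≤b
  a′≤a : toℕ a′ ≤ toℕ (suc a)
  a′≤a = ≤-trans (≤-reflexive (Fin.toℕ-inject₁ a)) (n≤1+n (toℕ a))
  widened : Mono col a′ b
  widened = ≤-trans a′≤a a<b , Sum.map (widen true) (widen false) side
  a≡1+a : toℕ a ≡ suc (toℕ a)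
  a≡1+a = trans (sym (Fin.toℕ-inject₁ a)) (cong toℕ (proj₁ (maximal a′ b a′≤a ≤-refl widened)))

IsBlock⇒startsAt : ∀ {k} (col : Fin k → Bool) {a b} → IsBlock col a b →
  startsAt (extend col) (toℕ a) ≡ true
IsBlock⇒startsAt col {zero}  _     = refl
IsBlock⇒startsAt {suc k} col {suc a} block =
  subst₂ (λ x y → x xor y ≡ true) (sym (extend-inject₁ col a)) (sym (extend-toℕ (col ∘ suc) a))
    (≢⇒xor≡true (IsBlock⇒boundary block))

IsBlock-start-injective : ∀ {k} {col : Fin k → Bool} {a b a′ b′} →
  IsBlock col a b → IsBlock col a′ b′ → toℕ a ≡ toℕ a′ → (a , b) ≡ (a′ , b′)
IsBlock-start-injective {b = b} {b′ = b′} block block′ a≡a′ with Fin.toℕ-injective a≡a′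
... | refl with ≤-total (toℕ b) (toℕ b′)
...   | inj₁ b≤b′ with refl ← proj₂ (proj₂ block _ _ ≤-refl b≤b′ (proj₁ block′)) = refl
...   | inj₂ b′≤b with refl ← proj₂ (proj₂ block′ _ _ ≤-refl b′≤b (proj₁ block)) = refl

distinctBlocks≤1+changes : ∀ {k} (col : Fin k → Bool) {m} (β : Fin m → Fin k × Fin k) →
  (∀ i i′ → β i ≡ β i′ → i ≡ i′) → (∀ i → IsBlock col (proj₁ (β i)) (proj₂ (β i))) →
  m ≤ suc (countBelow (changesAt (extend col)) k)
distinctBlocks≤1+changes {k} col β β-injective blocks =
  ≤-trans (Distinct⇒≤countBelow starts) (countBelow-startsAt (extend col) k)
  where
  starts : Distinct (startsAt (extend col)) k _
  starts = record
    { point     = toℕ ∘ proj₁ ∘ β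
    ; holds     = λ i → IsBlock⇒startsAt col (blocks i)
    ; below     = λ i → Fin.toℕ<n (proj₁ (β i))
    ; injective = λ {i} {l} same → β-injective i l (IsBlock-start-injective (blocks i) (blocks l) same)
    }

crossing-threshold : ∀ {k t} j → t < k → (k + 1 ≤ suc j + suc (k ∸ suc t)) ⇔ (t ≤ j)
crossing-threshold {k} {t} j t<k = mk⇔
  (λ le → s≤s⁻¹ (+-cancelʳ-≤ (suc u) (suc t) (suc j) (subst (_≤ suc j + suc u) k+1≡ le)))
  (λ t≤j → subst (_≤ suc j + suc u) (sym k+1≡) (+-monoˡ-≤ (suc u) (s≤s t≤j)))
  where
  u : ℕ
  u = k ∸ suc t
  k+1≡ : k + 1 ≡ suc t + suc u
  k+1≡ = begin
    k + 1              ≡⟨ cong (_+ 1) (m+[n∸m]≡n t<k) ⟨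
    (suc t + u) + 1    ≡⟨ +-comm _ 1 ⟩
    suc (suc t + u)    ≡⟨ +-suc (suc t) u ⟨
    suc t + suc u      ∎
    where open ≡-Reasoning

regularCrossing-adj : ∀ {n k} {G : Graph n k} {a b} → IsTriple G a b regular crossing →
  ∀ j t → (adj G (a , j) (b , opposite t) ≡ true) ⇔ (toℕ t ≤ toℕ j)
regularCrossing-adj {k = k} cross j t = ⇔.trans (cross j (opposite t))
  (subst (λ o → (k + 1 ≤ suc (toℕ j) + suc o) ⇔ (toℕ t ≤ toℕ j)) (sym (Fin.opposite-prop t))
         (crossing-threshold (toℕ j) (Fin.toℕ<n t)))

sum-of-four< : ∀ {r a b c d} → a < r → b < r → c < r → d < r → suc ((a + b) + (c + d)) < 4 * r
sum-of-four< {r} {a} {b} {c} {d} a<r b<r c<r d<r = begin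
  2 + ((a + b) + (c + d))     ≤⟨ +-monoʳ-≤ (2 + (a + b)) (m≤n+m (c + d) 2) ⟩
  (2 + (a + b)) + (2 + (c + d)) ≤⟨ +-mono-≤ (pair< a<r b<r) (pair< c<r d<r) ⟩
  (r + r) + (r + r)           ≡⟨ four-r r ⟩
  4 * r                       ∎
  where
  open ≤-Reasoning
  pair< : ∀ {x y} → x < r → y < r → 2 + (x + y) ≤ r + r
  pair< {x} {y} x<r y<r = subst (_≤ r + r) (cong suc (+-suc x y)) (+-mono-≤ x<r y<r)
  four-r : ∀ r → (r + r) + (r + r) ≡ 4 * r
  four-r = solve-∀

odd : ℕ → Bool
odd zero    = false
odd (suc n) = not (odd n)

odd-gap : ∀ {a b} → odd a ≡ odd b → a < b → suc a < b
odd-gap {a} same a<b with m≤n⇒m<n∨m≡n a<b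
... | inj₁ 1+a<b = 1+a<b
... | inj₂ refl  = contradiction same (not-¬ refl)

is : Bool → Bool → Bool
is true  b = b
is false b = not b

is-sound : ∀ π b → is π b ≡ true → b ≡ π
is-sound true  true  _ = refl
is-sound false false _ = refl

xor≡true⇒≡not : ∀ {x y} → x xor y ≡ true → x ≡ not y
xor≡true⇒≡not {true}  {false} _ = refl
xor≡true⇒≡not {false} {true}  _ = refl

xor≡false⇒≡ : ∀ {x y} → x xor y ≡ false → x ≡ y
xor≡false⇒≡ {true}  {true}  _ = refl
xor≡false⇒≡ {false} {false} _ = refl

module ChangeWitness (P Q : ℕ → Bool) where
  witness : ℕ → ℕ
  witness zero    = zero
  witness (suc a) = if Q a xor P a then a else suc a

  pred≤witness : ∀ a → pred a ≤ witness a
  pred≤witness zero    = z≤n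
  pred≤witness (suc a) with Q a xor P a
  ... | true  = ≤-refl
  ... | false = n≤1+n a

  witness≤ : ∀ a → witness a ≤ a
  witness≤ zero    = z≤n
  witness≤ (suc a) with Q a xor P a
  ... | true  = n≤1+n a
  ... | false = ≤-refl

  witness-opposite : ∀ a → changesAt P a ≡ true → Q (pred a) ≡ not (P (witness a))
  witness-opposite (suc a) change with Q a xor P a in differ
  ... | true  = xor≡true⇒≡not differ
  ... | false = trans (xor≡false⇒≡ differ) (xor≡true⇒≡not change)

  witness<pred : ∀ {a a′} → odd a ≡ odd a′ → a < a′ → witness a < pred a′
  witness<pred {a} same a<a′ = ≤-<-trans (witness≤ a) (pred-mono-≤ (odd-gap same a<a′))

module HalfGraph {n k} (G : Graph n k) {a b : Fin n} (cross : IsTriple G a b regular crossing)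
                 (Y : V n k → Bool) where
  P Q : ℕ → Bool
  P = extend (λ j → Y (a , j))
  Q = extend (λ t → Y (b , opposite t))
  open ChangeWitness P Q

  class : Bool → Bool → ℕ → Bool
  class π τ c = (changesAt P c ∧ is π (odd c)) ∧ is τ (P (witness c))

  changes-by-class : countBelow (changesAt P) k ≡
    (countBelow (class true true) k + countBelow (class true false) k) +
    (countBelow (class false true) k + countBelow (class false false) k)
  changes-by-class = trans (countBelow-split (changesAt P) odd k)
    (cong₂ _+_ (countBelow-split _ (P ∘ witness) k) (countBelow-split _ (P ∘ witness) k))

  module Ladder {π τ m} (d : Distinct (class π τ) k m) where
    open Distinct d public

    half-graph : ∀ j t → (adj G (a , j) (b , opposite t) ≡ true) ⇔ (toℕ t ≤ toℕ j)
    half-graph = regularCrossing-adj {G = G} {a} {b} cross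

    witness<k : ∀ i → witness (point i) < k
    witness<k i = ≤-<-trans (witness≤ _) (below i)

    pred<k : ∀ i → pred (point i) < k
    pred<k i = ≤-<-trans (pred≤witness (point i)) (witness<k i)

    x y : Fin m → V n k
    x i = (a , fromℕ< (witness<k i))
    y i = (b , opposite (fromℕ< (pred<k i)))

    change : ∀ i → changesAt P (point i) ≡ true
    change i = ∧-conicalˡ _ _ (∧-conicalˡ _ (is τ (P (witness (point i)))) (holds i))

    parity : ∀ i → odd (point i) ≡ π
    parity i = is-sound π _ (∧-conicalʳ (changesAt P (point i)) _ (∧-conicalˡ _ _ (holds i)))

    side : ∀ i → P (witness (point i)) ≡ τ
    side i = is-sound τ _ (∧-conicalʳ _ _ (holds i))

    x-side : ∀ i → Y (x i) ≡ τ
    x-side i = trans (sym (extend-fromℕ< _ (witness<k i))) (side i)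

    y-side : ∀ i → Y (y i) ≡ not τ
    y-side i = trans (sym (extend-fromℕ< _ (pred<k i)))
                     (trans (witness-opposite (point i) (change i)) (cong not (side i)))

    rung : ∀ i → adj G (x i) (y i) ≡ true
    rung i = Equivalence.from (half-graph _ _)
      (subst₂ _≤_ (sym (Fin.toℕ-fromℕ< _)) (sym (Fin.toℕ-fromℕ< _)) (pred≤witness (point i)))

    no-rung : ∀ i l → point i < point l → adj G (x i) (y l) ≡ false
    no-rung i l i<l = ¬-not λ edge → <⇒≱ gap (Equivalence.to (half-graph _ _) edge)
      where
      gap : toℕ (fromℕ< (witness<k i)) < toℕ (fromℕ< (pred<k l))
      gap = subst₂ _<_ (sym (Fin.toℕ-fromℕ< _)) (sym (Fin.toℕ-fromℕ< _))
                   (witness<pred (trans (parity i) (sym (parity l))) i<l)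

  ladder⇒IndepRows : ∀ {π m} τ → Distinct (class π τ) k m → Σ (Fin m → V n k) (IndepRows G Y)
  ladder⇒IndepRows {π} true d =
    x , triangular⇒IndepRows G Y x y (λ i → k ∸ point i) x-side y-side rung upper
          (λ same → injective (∸-cancelˡ-≡ (<⇒≤ (below _)) (<⇒≤ (below _)) same))
    where
    open Ladder {π} {true} d
    upper : ∀ i l → k ∸ point l < k ∸ point i → adj G (x i) (y l) ≡ false
    upper i l lt = no-rung i l (≰⇒> λ l≤i → <⇒≱ lt (∸-monoʳ-≤ k l≤i))
  ladder⇒IndepRows {π} false d =
    y , triangular⇒IndepRows G Y y x point y-side x-side
          (λ i → trans (adj-sym G _ _) (rung i))
          (λ i l l<i → trans (adj-sym G _ _) (no-rung l i l<i)) injective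
    where open Ladder {π} {false} d

  class-count<rank : ∀ {r} → RankLess G Y r → ∀ π τ → countBelow (class π τ) k < r
  class-count<rank {r} rank<r π τ = ≰⇒> λ r≤count →
    let ρ , independent = ladder⇒IndepRows {π} τ (≤countBelow⇒Distinct _ k r r≤count)
    in <-irrefl refl (rank<r r ρ independent)

  fewerBlocks : ∀ {r} → RankLess G Y r → FewerBlocksThan (λ j → Y (a , j)) (4 * r)
  fewerBlocks {r} rank<r m β β-injective blocks = begin-strict
    m                                   ≤⟨ distinctBlocks≤1+changes _ β β-injective blocks ⟩
    suc (countBelow (changesAt P) k)    ≡⟨ cong suc changes-by-class ⟩
    suc ((countBelow (class true true) k + countBelow (class true false) k) +
         (countBelow (class false true) k + countBelow (class false false) k))
                                        <⟨ sum-of-four< (bound true true) (bound true false)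
                                                        (bound false true) (bound false false) ⟩
    4 * r                               ∎
    where
    open ≤-Reasoning
    bound : ∀ π τ → countBelow (class π τ) k < r
    bound = class-count<rank rank<r

Carousel⇒firstCrossing : ∀ {n k} {G : Graph (3 + n) k} {last} → Carousel G last →
  IsTriple G zero (suc zero) regular crossing
Carousel⇒firstCrossing {G = G} c =
  subst (IsTriple G zero (suc zero) regular) (firstCross c zero refl)
        (triples c zero (suc zero) (inj₁ refl))

underlyingCarousel : ∀ {n k} {G : Graph n k} {s} → EvenCarousel G s ⊎ OddCarousel G s → Σ Shape (Carousel G)
underlyingCarousel (inj₁ (_ , c , _)) = expanding , c
underlyingCarousel (inj₂ (_ , c , _)) = skewExpanding , c

lemma6 : (n s r k : ℕ) → (h : 3 ≤ n) → 1 ≤ s → 2 ≤ r →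
    (G : Graph n k) → (EvenCarousel G s ⊎ OddCarousel G s) →
    (Y : V n k → Bool) → RankLess G Y r →
    FewerBlocksThan (λ j → Y (firstIdx h , j)) (8 * r)
lemma6 _ s r _ (s≤s (s≤s (s≤s _))) _ _ G carousel Y rank<r m β β-injective blocks =
  <-≤-trans (HalfGraph.fewerBlocks G cross Y rank<r m β β-injective blocks) (*-monoˡ-≤ r 4≤8)
  where
  cross : IsTriple G zero (suc zero) regular crossing
  cross = Carousel⇒firstCrossing (proj₂ (underlyingCarousel {s = s} carousel))
  4≤8 : 4 ≤ 8
  4≤8 = s≤s (s≤s (s≤s (s≤s z≤n)))
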